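{- Let $M$ be a simple matroid. The elements $\zeta^F$, $F\in L(M)$, form a $\mathbb Z$-basis of $\mathcal H_p(M)$, and for every $\beta\in\mathcal H_p(M)$, \[\beta=\sum_{F\in L(M)}\beta_F(0)\,\zeta^F.\]
   Context: $L(M)$ is the lattice of flats with rank function $\operatorname{rk}$. $\mathcal H(M)$ is the free $\mathbb Z[t,t^{ -1}]$-module with basis $L(M)$; elements are written $\alpha=\sum_F\alpha_F\cdot F$. $\mathsf{Pal}(0)$ is the set of $h\in\mathbb Z[t,t^{ -1}]$ with $h(t)=h(t^{ -1})$. $\mathcal H_p(M)$ is the abelian subgroup of $\alpha\in\mathcal H(M)$ such that for every flat $F$, $\alpha_F\in\mathbb Z[t]$ and $\sum_{G\supseteq F}t^{\operatorname{rk}F-\operatorname{rk}G}\alpha_G\in\mathsf{Pal}(0)$. For a flat $F$, $\zeta^F=\sum_{G\subseteq F}t^{\operatorname{rk}F-\operatorname{rk}G}P_{M^F_G}(t^{ -2})\cdot G$, where $M^F_G$ is the matroid whose lattice of flats is the interval $[G,F]$ of $L(M)$ and $P_N(t)$ is the Kazhdan–Lusztig polynomial (the unique family with $P_N=1$ if $\operatorname{rk}N=0$, $\deg P_N<(\operatorname{rk}N)/2$ if $\operatorname{rk}N>0$, and $Z_N(t)=\sum_{F\in L(N)}t^{\operatorname{rk}F}P_{N_F}(t)$ satisfying $Z_N(t)=t^{\operatorname{rk}N}Z_N(t^{ -1})$, $N_F$ the contraction at $F$). -}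

module Defs where

open import Data.Nat as ℕ using (ℕ; zero; suc; _≤_; _<_; _%_; _/_; _≡ᵇ_)
open import Data.Integer as ℤ using (ℤ; +_; -[1+_]; 0ℤ; 1ℤ)
open import Data.Bool using (if_then_else_)
open import Data.Fin using (Fin)
open import Data.Fin.Subset using (Subset; inside; outside; _⊆_; _∈_; _∉_; _∪_; _∩_; ⁅_⁆; ∣_∣)
open import Data.Fin.Subset.Properties using (_∈?_; _⊆?_)
open import Data.Fin.Properties using (all?)
open import Data.Nat.Properties using (_<?_)
open import Data.List using (List; []; _∷_; _++_; map; filter; foldr)
open import Data.Vec using (_∷_; [])
open import Data.Product using (_×_; ∃)
open import Data.Sum using (_⊎_)
open import Relation.Nullary using (Dec; ¬_; does)
open import Relation.Nullary.Decidable.Core using (_⊎-dec_)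
open import Relation.Binary.PropositionalEquality using (_≡_; _≢_)

record Matroid (n : ℕ) : Set where
  field
    rk        : Subset n → ℕ
    rk-bound  : ∀ X → rk X ≤ ∣ X ∣
    rk-mono   : ∀ X Y → X ⊆ Y → rk X ≤ rk Y
    rk-submod : ∀ X Y → rk (X ∪ Y) ℕ.+ rk (X ∩ Y) ≤ rk X ℕ.+ rk Y

open Matroid public

IsSimple : ∀ {n} → Matroid n → Set
IsSimple M = (∀ e → rk M ⁅ e ⁆ ≡ 1)
           × (∀ e f → e ≢ f → rk M (⁅ e ⁆ ∪ ⁅ f ⁆) ≡ 2)

IsFlat : ∀ {n} → Matroid n → Subset n → Set
IsFlat M X = ∀ e → e ∈ X ⊎ rk M X < rk M (X ∪ ⁅ e ⁆)

isFlat? : ∀ {n} (M : Matroid n) (X : Subset n) → Dec (IsFlat M X)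
isFlat? M X = all? (λ e → (e ∈? X) ⊎-dec (rk M X <? rk M (X ∪ ⁅ e ⁆)))

subsets : (n : ℕ) → List (Subset n)
subsets zero    = [] ∷ []
subsets (suc n) = map (outside ∷_) (subsets n) ++ map (inside ∷_) (subsets n)

flats : ∀ {n} → Matroid n → List (Subset n)
flats M = filter (isFlat? M) (subsets _)

sumℤ : List ℤ → ℤ
sumℤ = foldr ℤ._+_ 0ℤ

ΣL : ∀ {n} → Matroid n → (Subset n → ℤ) → ℤ
ΣL M f = sumℤ (map f (flats M))


when : ∀ {a} {A : Set a} → Dec A → ℤ → ℤ
when d x = if does d then x else 0ℤ

rkℤ : ∀ {n} → Matroid n → Subset n → ℤ
rkℤ M X = + (rk M X)

-- Laurent polynomials in ℤ[t,t⁻¹] are represented by their coefficient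
-- functions ℤ → ℤ (f k = coefficient of t^k); finiteness of support is
-- imposed explicitly where needed.

InZt : (ℤ → ℤ) → Set
InZt f = (∀ k → k ℤ.< 0ℤ → f k ≡ 0ℤ)
       × ∃ (λ (N : ℕ) → ∀ k → + N ℤ.< k → f k ≡ 0ℤ)

Pal0 : (ℤ → ℤ) → Set
Pal0 f = ∀ k → f k ≡ f (ℤ.- k)

-- coefficient of t^k in t^r · f(t⁻²):  f i  where r - 2i = k
tPowInv2 : ℤ → (ℤ → ℤ) → ℤ → ℤ
tPowInv2 r f k with r ℤ.- k
... | + m      = if (m % 2) ≡ᵇ 0 then f (+ (m / 2)) else 0ℤ
... | -[1+ m ] = if (suc m % 2) ≡ᵇ 0 then f (ℤ.- (+ (suc m / 2))) else 0ℤ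

-- P G F k is the coefficient of t^k in P_{M^F_G}(t), for flats G ⊆ F.
-- M^F_G has lattice of flats [G,F] and rank rk F - rk G; its contraction
-- at a flat H ∈ [G,F] has lattice [H,F], and rank of H in M^F_G is
-- rk H - rk G.

KLFamily : ℕ → Set
KLFamily n = Subset n → Subset n → ℤ → ℤ

-- Z_{M^F_G}(t) = Σ_{H ∈ [G,F]} t^{rk H - rk G} P_{M^F_H}(t), coefficientwise
ZKL : ∀ {n} → Matroid n → KLFamily n → Subset n → Subset n → ℤ → ℤ
ZKL M P G F k =
  ΣL M (λ H → when (G ⊆? H) (when (H ⊆? F)
         (P H F (k ℤ.- (rkℤ M H ℤ.- rkℤ M G)))))

record IsKL {n} (M : Matroid n) (P : KLFamily n) : Set where
  field
    poly    : ∀ G F → IsFlat M G → IsFlat M F → G ⊆ F →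
              ∀ k → k ℤ.< 0ℤ → P G F k ≡ 0ℤ
    rank0   : ∀ G F → IsFlat M G → IsFlat M F → G ⊆ F →
              rk M F ≡ rk M G →
              ∀ k → P G F k ≡ (if does (k ℤ.≟ 0ℤ) then 1ℤ else 0ℤ)
    degree  : ∀ G F → IsFlat M G → IsFlat M F → G ⊆ F →
              rk M G < rk M F →
              ∀ k → rkℤ M F ℤ.- rkℤ M G ℤ.≤ (+ 2) ℤ.* k → P G F k ≡ 0ℤ
    palin   : ∀ G F → IsFlat M G → IsFlat M F → G ⊆ F →
              ∀ k → ZKL M P G F k ≡ ZKL M P G F ((rkℤ M F ℤ.- rkℤ M G) ℤ.- k)

-- H(M): elements α = Σ_F α_F · F, represented by α F k = coefficient of
-- t^k in α_F (only the values at flats F are relevant).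

HElt : ℕ → Set
HElt n = Subset n → ℤ → ℤ

-- coefficientwise:  Σ_{G ⊇ F} t^{rk F - rk G} α_G
upSum : ∀ {n} → Matroid n → HElt n → Subset n → ℤ → ℤ
upSum M α F k =
  ΣL M (λ G → when (F ⊆? G) (α G (k ℤ.+ (rkℤ M G ℤ.- rkℤ M F))))

InHp : ∀ {n} → Matroid n → HElt n → Set
InHp M α = (∀ F → IsFlat M F → InZt (α F))
         × (∀ F → IsFlat M F → Pal0 (upSum M α F))

ζ : ∀ {n} → Matroid n → KLFamily n → Subset n → HElt n
ζ M P F G = λ k → when (G ⊆? F) (tPowInv2 (rkℤ M F ℤ.- rkℤ M G) (P G F) k)

ζComb : ∀ {n} → Matroid n → KLFamily n → (Subset n → ℤ) → HElt n
ζComb M P c G k = ΣL M (λ F → c F ℤ.* ζ M P F G k)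

_≈H[_]_ : ∀ {n} → HElt n → Matroid n → HElt n → Set
α ≈H[ M ] β = ∀ G → IsFlat M G → ∀ k → α G k ≡ β G k

-- At t = 0 the element ζ^F has coefficient 1 at F and 0 at every other flat: at G ⊂ F a constant
-- term of t^(rk F - rk G) P(t^-2) would need 2 deg P = rk F - rk G, which the degree bound
-- excludes.  Hence Σ_F c_F ζ^F has constant coefficient c_G at G, giving independence.  The upward
-- sum of ζ^F at H is t^(rk F - rk H) Z(t^-2) with Z = Z_{M^F_H}, so the palindromicity of Z is
-- exactly what puts ζ^F in H_p(M).  For spanning, the residual β - Σ_F β_F(0) ζ^F lies in H_p(M)
-- and vanishes in degrees ≤ 0.  Such an element is zero by descending induction on flats: once it
-- vanishes above F, its upward sum at F is its own F-coefficient, a palindromic Laurent polynomial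
-- without terms of degree ≤ 0.

module Submission where

open import Defs
open import Data.Nat using (ℕ)
open import Data.Integer using (ℤ; 0ℤ)
open import Data.Fin.Subset using (Subset)
open import Data.Product using (_×_)
open import Relation.Binary.PropositionalEquality using (_≡_)

open import Data.Bool using (if_then_else_)
open import Data.Fin.Properties using (¬∀⟶∃¬)
open import Data.Fin.Subset using (inside; outside; _⊆_; _⊂_; _∈_; _∪_; ⁅_⁆)
open import Data.Fin.Subset.Properties
  using (_⊆?_; _∈?_; ⊆-antisym; ⊆-refl; ⊆-trans; ∣p∣≤n; x∈⁅y⁆⇒x≡y; x∈p∪q⁻)
open import Data.Integer as ℤ using (+_; -[1+_]; 1ℤ; _+_; _-_; _*_; -_; _<_; _≤_; +≤+)
import Data.Integer.Properties as ℤP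
open import Data.Integer.Tactic.RingSolver using (solve-∀)
open import Data.List using (_∷_; []; _++_; map; filter)
import Data.List.Properties as List
open import Data.Nat as ℕ using (zero; suc; _∸_)
open import Data.Nat.DivMod using (_%_; _/_; m*n%n≡0; m*n/n≡m; [m+kn]%n≡m%n)
open import Data.Nat.Induction using (<-rec)
import Data.Nat.Properties as ℕP
open import Data.Product using (_,_; proj₁; proj₂)
open import Data.Sum using (inj₁; inj₂)
open import Data.Vec using (_∷_; [])
import Data.Vec.Properties as Vec
open import Function using (_∘_)
open import Relation.Nullary using (Dec; ¬_; yes; no; contradiction)
open import Relation.Nullary.Decidable using (dec-false; _→-dec_)
open import Relation.Binary.PropositionalEquality
  using (_≢_; refl; sym; trans; cong; cong₂; subst; module ≡-Reasoning)

private
  variable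
    A B : Set

data ParityView (j : ℤ) : Set where
  even : ∀ q → j ≡ + 2 * q → ParityView j
  odd  : ∀ q → j ≡ + 2 * q + 1ℤ → ParityView j

parityView-suc : ∀ {j} → ParityView j → ParityView (1ℤ + j)
parityView-suc (even q j≡2q) =
  odd q (trans (cong (λ x → 1ℤ + x) j≡2q) (ℤP.+-comm 1ℤ (+ 2 * q)))
parityView-suc (odd q j≡2q+1) =
  even (q + 1ℤ) (trans (cong (λ x → 1ℤ + x) j≡2q+1) (carry q))
  where
  carry : ∀ q → 1ℤ + (+ 2 * q + 1ℤ) ≡ + 2 * (q + 1ℤ)
  carry = solve-∀

parityView-neg : ∀ {j} → ParityView j → ParityView (- j)
parityView-neg (even q j≡2q) =
  even (- q) (trans (cong -_ j≡2q) (ℤP.neg-distribʳ-* (+ 2) q))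
parityView-neg (odd q j≡2q+1) =
  odd (- q - 1ℤ) (trans (cong -_ j≡2q+1) (negate q))
  where
  negate : ∀ q → - (+ 2 * q + 1ℤ) ≡ + 2 * (- q - 1ℤ) + 1ℤ
  negate = solve-∀

parityView-ℕ : ∀ m → ParityView (+ m)
parityView-ℕ zero    = even 0ℤ refl
parityView-ℕ (suc m) = parityView-suc (parityView-ℕ m)

parityView : ∀ j → ParityView j
parityView (+ m)    = parityView-ℕ m
parityView -[1+ m ] = parityView-neg (parityView-ℕ (suc m))

-- the coefficient of t^(-j) in f(t^-2)
ifEven : (ℤ → ℤ) → ℤ → ℤ
ifEven f (+ m)    = if m % 2 ℕ.≡ᵇ 0 then f (+ (m / 2)) else 0ℤ
ifEven f -[1+ m ] = if suc m % 2 ℕ.≡ᵇ 0 then f (- + (suc m / 2)) else 0ℤ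

tPowInv2≡ifEven : ∀ r f k → tPowInv2 r f k ≡ ifEven f (r - k)
tPowInv2≡ifEven r f k with r - k
... | + m      = refl
... | -[1+ m ] = refl

ifEven-evenBranch : ∀ (g : ℕ → ℤ) h →
                    (if h ℕ.* 2 % 2 ℕ.≡ᵇ 0 then g (h ℕ.* 2 / 2) else 0ℤ) ≡ g h
ifEven-evenBranch g h =
  trans (cong (λ r → if r ℕ.≡ᵇ 0 then g (h ℕ.* 2 / 2) else 0ℤ) (m*n%n≡0 h 2))
        (cong g (m*n/n≡m h 2))

ifEven-oddBranch : ∀ (g : ℕ → ℤ) h →
  (if (1 ℕ.+ h ℕ.* 2) % 2 ℕ.≡ᵇ 0 then g ((1 ℕ.+ h ℕ.* 2) / 2) else 0ℤ) ≡ 0ℤ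
ifEven-oddBranch g h =
  cong (λ r → if r ℕ.≡ᵇ 0 then g ((1 ℕ.+ h ℕ.* 2) / 2) else 0ℤ) ([m+kn]%n≡m%n 1 h 2)

2*+≡+*2 : ∀ h → + 2 * + h ≡ + (h ℕ.* 2)
2*+≡+*2 h = trans (sym (ℤP.pos-* 2 h)) (cong +_ (ℕP.*-comm 2 h))

ifEven-even : ∀ f q → ifEven f (+ 2 * q) ≡ f q
ifEven-even f (+ h) =
  trans (cong (ifEven f) (2*+≡+*2 h)) (ifEven-evenBranch (λ m → f (+ m)) h)
ifEven-even f -[1+ h ] =
  trans (cong (ifEven f) 2*-[1+h]≡-[2+2h]) (ifEven-evenBranch (λ m → f (- + m)) (suc h))
  where
  2*-[1+h]≡-[2+2h] : + 2 * -[1+ h ] ≡ - + (suc h ℕ.* 2)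
  2*-[1+h]≡-[2+2h] =
    trans (sym (ℤP.neg-distribʳ-* (+ 2) (+ suc h))) (cong -_ (2*+≡+*2 (suc h)))

ifEven-odd : ∀ f q → ifEven f (+ 2 * q + 1ℤ) ≡ 0ℤ
ifEven-odd f (+ h) =
  trans (cong (ifEven f) (trans (cong (_+ 1ℤ) (2*+≡+*2 h)) (ℤP.+-comm (+ (h ℕ.* 2)) 1ℤ)))
        (ifEven-oddBranch (λ m → f (+ m)) h)
ifEven-odd f -[1+ h ] =
  trans (cong (ifEven f) (trans (oddNeg (+ h)) (cong (λ x → - (1ℤ + x)) (2*+≡+*2 h))))
        (ifEven-oddBranch (λ m → f (- + m)) h)
  where
  oddNeg : ∀ Q → + 2 * - (1ℤ + Q) + 1ℤ ≡ - (1ℤ + + 2 * Q)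
  oddNeg = solve-∀

tPowInv2-even : ∀ r f k q → r - k ≡ + 2 * q → tPowInv2 r f k ≡ f q
tPowInv2-even r f k q r-k≡2q =
  trans (tPowInv2≡ifEven r f k) (trans (cong (ifEven f) r-k≡2q) (ifEven-even f q))

tPowInv2-odd : ∀ r f k q → r - k ≡ + 2 * q + 1ℤ → tPowInv2 r f k ≡ 0ℤ
tPowInv2-odd r f k q r-k≡2q+1 =
  trans (tPowInv2≡ifEven r f k) (trans (cong (ifEven f) r-k≡2q+1) (ifEven-odd f q))

tPowInv2-translate : ∀ {r k r′ k′} s f g → r′ - k′ ≡ (r - k) + + 2 * s →
                     (∀ q → g (q + s) ≡ f q) → tPowInv2 r f k ≡ tPowInv2 r′ g k′
tPowInv2-translate {r} {k} {r′} {k′} s f g r′-k′≡r-k+2s g≗f with parityView (r - k)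
... | even q e = trans (tPowInv2-even r f k q e)
  (trans (sym (g≗f q)) (sym (tPowInv2-even r′ g k′ (q + s) (trans r′-k′≡r-k+2s shifted))))
  where
  shifted : (r - k) + + 2 * s ≡ + 2 * (q + s)
  shifted = trans (cong (_+ + 2 * s) e) (sym (ℤP.*-distribˡ-+ (+ 2) q s))
... | odd q e = trans (tPowInv2-odd r f k q e)
  (sym (tPowInv2-odd r′ g k′ (q + s)
         (trans r′-k′≡r-k+2s (trans (cong (_+ + 2 * s) e) (shifted q s)))))
  where
  shifted : ∀ q s → + 2 * q + 1ℤ + + 2 * s ≡ + 2 * (q + s) + 1ℤ
  shifted = solve-∀

tPowInv2-cong : ∀ r {f g} k → (∀ q → f q ≡ g q) → tPowInv2 r f k ≡ tPowInv2 r g k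
tPowInv2-cong r {f} {g} k f≗g = tPowInv2-translate {r} {k} {r} {k} 0ℤ f g
  (sym (ℤP.+-identityʳ (r - k))) (λ q → trans (cong g (ℤP.+-identityʳ q)) (sym (f≗g q)))

tPowInv2-shift : ∀ r s f k → tPowInv2 r f (k + s) ≡ tPowInv2 (r + s) (λ j → f (j - s)) k
tPowInv2-shift r s f k = tPowInv2-translate {r} {k + s} {r + s} {k} s f (λ j → f (j - s))
  (shifted r s k) (λ q → cong f (+-cancelʳ q s))
  where
  shifted : ∀ r s k → (r + s) - k ≡ (r - (k + s)) + + 2 * s
  shifted = solve-∀
  +-cancelʳ : ∀ q s → (q + s) - s ≡ q
  +-cancelʳ = solve-∀

tPowInv2-reflect : ∀ r f k → tPowInv2 r f k ≡ tPowInv2 r (λ i → f (r - i)) (- k)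
tPowInv2-reflect r f k = reflectBy (parityView (r - k))
  where
  reflected : ∀ r k → r - - k ≡ + 2 * r - (r - k)
  reflected = solve-∀
  reflectBy : ParityView (r - k) → tPowInv2 r f k ≡ tPowInv2 r (λ i → f (r - i)) (- k)
  reflectBy (even q e) = trans (tPowInv2-even r f k q e) (trans (cong f (sym (involutive r q)))
    (sym (tPowInv2-even r _ (- k) (r - q)
      (trans (reflected r k) (trans (cong (λ x → + 2 * r - x) e) (evenDiff r q))))))
    where
    involutive : ∀ r q → r - (r - q) ≡ q
    involutive = solve-∀
    evenDiff : ∀ r q → + 2 * r - + 2 * q ≡ + 2 * (r - q)
    evenDiff = solve-∀
  reflectBy (odd q e) = trans (tPowInv2-odd r f k q e)
    (sym (tPowInv2-odd r _ (- k) (r - q - 1ℤ)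
      (trans (reflected r k) (trans (cong (λ x → + 2 * r - x) e) (oddDiff r q)))))
    where
    oddDiff : ∀ r q → + 2 * r - (+ 2 * q + 1ℤ) ≡ + 2 * (r - q - 1ℤ) + 1ℤ
    oddDiff = solve-∀

tPowInv2-map : ∀ r (h : ℤ → ℤ) → h 0ℤ ≡ 0ℤ →
               ∀ f k → h (tPowInv2 r f k) ≡ tPowInv2 r (λ j → h (f j)) k
tPowInv2-map r h h0≡0 f k with parityView (r - k)
... | even q e = trans (cong h (tPowInv2-even r f k q e)) (sym (tPowInv2-even r _ k q e))
... | odd q e  = trans (cong h (tPowInv2-odd r f k q e)) (trans h0≡0 (sym (tPowInv2-odd r _ k q e)))

sumℤ-zero : ∀ (f : A → ℤ) xs → (∀ x → f x ≡ 0ℤ) → sumℤ (map f xs) ≡ 0ℤ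
sumℤ-zero f []       f≗0 = refl
sumℤ-zero f (x ∷ xs) f≗0 = cong₂ _+_ (f≗0 x) (sumℤ-zero f xs f≗0)

sumℤ-++ : ∀ xs ys → sumℤ (xs ++ ys) ≡ sumℤ xs + sumℤ ys
sumℤ-++ []       ys = sym (ℤP.+-identityˡ _)
sumℤ-++ (x ∷ xs) ys = trans (cong (λ s → x + s) (sumℤ-++ xs ys)) (sym (ℤP.+-assoc x _ _))

sumℤ-map-+ : ∀ (f g : A → ℤ) xs →
             sumℤ (map (λ x → f x + g x) xs) ≡ sumℤ (map f xs) + sumℤ (map g xs)
sumℤ-map-+ f g []       = refl
sumℤ-map-+ f g (x ∷ xs) =
  trans (cong (λ s → f x + g x + s) (sumℤ-map-+ f g xs)) (interchange (f x) (g x) _ _)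
  where
  interchange : ∀ a b c d → (a + b) + (c + d) ≡ (a + c) + (b + d)
  interchange = solve-∀

sumℤ-map-- : ∀ (f g : A → ℤ) xs →
             sumℤ (map (λ x → f x - g x) xs) ≡ sumℤ (map f xs) - sumℤ (map g xs)
sumℤ-map-- f g []       = refl
sumℤ-map-- f g (x ∷ xs) =
  trans (cong (λ s → f x - g x + s) (sumℤ-map-- f g xs)) (interchange (f x) (g x) _ _)
  where
  interchange : ∀ a b c d → (a - b) + (c - d) ≡ (a + c) - (b + d)
  interchange = solve-∀

sumℤ-map-*ˡ : ∀ c (f : A → ℤ) xs → sumℤ (map (λ x → c * f x) xs) ≡ c * sumℤ (map f xs)
sumℤ-map-*ˡ c f []       = sym (ℤP.*-zeroʳ c)
sumℤ-map-*ˡ c f (x ∷ xs) =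
  trans (cong (λ s → c * f x + s) (sumℤ-map-*ˡ c f xs)) (sym (ℤP.*-distribˡ-+ c (f x) _))

sumℤ-swap : ∀ (h : A → B → ℤ) xs ys →
            sumℤ (map (λ x → sumℤ (map (h x) ys)) xs) ≡
            sumℤ (map (λ y → sumℤ (map (λ x → h x y) xs)) ys)
sumℤ-swap h []       ys = sym (sumℤ-zero (λ _ → 0ℤ) ys (λ _ → refl))
sumℤ-swap h (x ∷ xs) ys =
  trans (cong (λ s → sumℤ (map (h x) ys) + s) (sumℤ-swap h xs ys))
        (sym (sumℤ-map-+ (h x) (λ y → sumℤ (map (λ x → h x y) xs)) ys))

sumℤ-filter : ∀ {P : A → Set} (P? : ∀ x → Dec (P x)) (f : A → ℤ) xs →
              sumℤ (map f (filter P? xs)) ≡ sumℤ (map (λ x → when (P? x) (f x)) xs)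
sumℤ-filter P? f []       = refl
sumℤ-filter P? f (x ∷ xs) with P? x
... | yes _ = cong (λ s → f x + s) (sumℤ-filter P? f xs)
... | no _  = trans (sumℤ-filter P? f xs) (sym (ℤP.+-identityˡ _))

when-vanishes : ∀ (d : Dec A) {x} → (A → x ≡ 0ℤ) → when d x ≡ 0ℤ
when-vanishes (yes a) x≡0 = x≡0 a
when-vanishes (no _)  x≡0 = refl

when-holds : ∀ (d : Dec A) → A → ∀ x → when d x ≡ x
when-holds (yes _) a x = refl
when-holds (no ¬a) a x = contradiction a ¬a

when-cong : ∀ (d : Dec A) {x y} → (A → x ≡ y) → when d x ≡ when d y
when-cong (yes a) x≡y = x≡y a
when-cong (no _)  x≡y = refl

when-distrib-- : ∀ (d : Dec A) x y → when d (x - y) ≡ when d x - when d y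
when-distrib-- (yes _) x y = refl
when-distrib-- (no _)  x y = refl

when-*ˡ : ∀ (d : Dec A) c x → when d (c * x) ≡ c * when d x
when-*ˡ (yes _) c x = refl
when-*ˡ (no _)  c x = sym (ℤP.*-zeroʳ c)

when-sumℤ : ∀ (d : Dec A) (f : B → ℤ) ys →
            when d (sumℤ (map f ys)) ≡ sumℤ (map (λ y → when d (f y)) ys)
when-sumℤ (yes _) f ys = refl
when-sumℤ (no _)  f ys = sym (sumℤ-zero (λ _ → 0ℤ) ys (λ _ → refl))

tPowInv2-when : ∀ (d : Dec A) r f k →
                when d (tPowInv2 r f k) ≡ tPowInv2 r (λ j → when d (f j)) k
tPowInv2-when d r = tPowInv2-map r (when d) (when-vanishes d (λ _ → refl))

tPowInv2-sumℤ : ∀ r (g : A → ℤ → ℤ) xs k →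
                tPowInv2 r (λ j → sumℤ (map (λ x → g x j) xs)) k ≡
                sumℤ (map (λ x → tPowInv2 r (g x) k) xs)
tPowInv2-sumℤ r g xs k with parityView (r - k)
... | even q e = trans (tPowInv2-even r _ k q e)
  (cong sumℤ (sym (List.map-cong (λ x → tPowInv2-even r (g x) k q e) xs)))
... | odd q e  = trans (tPowInv2-odd r _ k q e)
  (sym (sumℤ-zero _ xs (λ x → tPowInv2-odd r (g x) k q e)))

sumℤ-subsets-suc : ∀ n (g : Subset (suc n) → ℤ) →
                   sumℤ (map g (subsets (suc n))) ≡
                   sumℤ (map (λ X → g (outside ∷ X)) (subsets n)) +
                   sumℤ (map (λ X → g (inside ∷ X)) (subsets n))
sumℤ-subsets-suc n g = begin
  sumℤ (map g (map (outside ∷_) S ++ map (inside ∷_) S))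
    ≡⟨ cong sumℤ (List.map-++ g (map (outside ∷_) S) _) ⟩
  sumℤ (map g (map (outside ∷_) S) ++ map g (map (inside ∷_) S))
    ≡⟨ sumℤ-++ (map g (map (outside ∷_) S)) _ ⟩
  sumℤ (map g (map (outside ∷_) S)) + sumℤ (map g (map (inside ∷_) S))
    ≡⟨ cong₂ _+_ (cong sumℤ (sym (List.map-∘ S))) (cong sumℤ (sym (List.map-∘ S))) ⟩
  sumℤ (map (λ X → g (outside ∷ X)) S) + sumℤ (map (λ X → g (inside ∷ X)) S) ∎
  where
  open ≡-Reasoning
  S = subsets n

sumℤ-subsets-single : ∀ n (g : Subset n → ℤ) G → (∀ X → X ≢ G → g X ≡ 0ℤ) →
                      sumℤ (map g (subsets n)) ≡ g G
sumℤ-subsets-single zero g [] g≗0 = ℤP.+-identityʳ (g [])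
sumℤ-subsets-single (suc n) g (outside ∷ G) g≗0 = trans (sumℤ-subsets-suc n g)
  (trans (cong₂ _+_ (sumℤ-subsets-single n _ G (λ X X≢G → g≗0 _ (X≢G ∘ Vec.∷-injectiveʳ)))
                    (sumℤ-zero _ (subsets n) (λ X → g≗0 _ λ ())))
         (ℤP.+-identityʳ _))
sumℤ-subsets-single (suc n) g (inside ∷ G) g≗0 = trans (sumℤ-subsets-suc n g)
  (trans (cong₂ _+_ (sumℤ-zero _ (subsets n) (λ X → g≗0 _ λ ()))
                    (sumℤ-subsets-single n _ G (λ X X≢G → g≗0 _ (X≢G ∘ Vec.∷-injectiveʳ))))
         (ℤP.+-identityˡ _))

⊆∧≢⇒⊂ : ∀ {n} {p q : Subset n} → p ⊆ q → p ≢ q → p ⊂ q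
⊆∧≢⇒⊂ {n} {p} {q} p⊆q p≢q with ¬∀⟶∃¬ n (λ x → x ∈ q → x ∈ p) (λ x → x ∈? q →-dec x ∈? p)
                                        (λ q⊆p → p≢q (⊆-antisym p⊆q (q⊆p _)))
... | x , x∈q⇏x∈p with x ∈? q
...   | yes x∈q = p⊆q , x , x∈q , λ x∈p → x∈q⇏x∈p (λ _ → x∈p)
...   | no x∉q  = contradiction (λ x∈q → contradiction x∈q x∉q) x∈q⇏x∈p

0ᴴ : ∀ {n} → HElt n
0ᴴ _ _ = 0ℤ

_-ᴴ_ : ∀ {n} → HElt n → HElt n → HElt n
(α -ᴴ β) F k = α F k - β F k

module _ {n} (M : Matroid n) where

  ΣL≡sumℤ-subsets : ∀ f → ΣL M f ≡ sumℤ (map (λ X → when (isFlat? M X) (f X)) (subsets n))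
  ΣL≡sumℤ-subsets f = sumℤ-filter (isFlat? M) f (subsets n)

  ΣL-cong : ∀ {f g} → (∀ F → IsFlat M F → f F ≡ g F) → ΣL M f ≡ ΣL M g
  ΣL-cong {f} {g} f≗g = trans (ΣL≡sumℤ-subsets f)
    (trans (cong sumℤ (List.map-cong (λ X → when-cong (isFlat? M X) (f≗g X)) (subsets n)))
           (sym (ΣL≡sumℤ-subsets g)))

  ΣL-vanishes : ∀ {f} → (∀ F → IsFlat M F → f F ≡ 0ℤ) → ΣL M f ≡ 0ℤ
  ΣL-vanishes f≗0 = trans (ΣL-cong f≗0) (sumℤ-zero (λ _ → 0ℤ) (flats M) (λ _ → refl))

  ΣL-single : ∀ f G → IsFlat M G → (∀ F → IsFlat M F → F ≢ G → f F ≡ 0ℤ) → ΣL M f ≡ f G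
  ΣL-single f G flatG f≗0 = trans (ΣL≡sumℤ-subsets f)
    (trans (sumℤ-subsets-single n _ G (λ X X≢G →
              when-vanishes (isFlat? M X) (λ flatX → f≗0 X flatX X≢G)))
           (when-holds (isFlat? M G) flatG (f G)))

  rk≤n : ∀ X → rk M X ℕ.≤ n
  rk≤n X = ℕP.≤-trans (rk-bound M X) (∣p∣≤n X)

  flat-⊂⇒rk< : ∀ {F G} → IsFlat M F → F ⊂ G → rk M F ℕ.< rk M G
  flat-⊂⇒rk< {F} {G} flatF (F⊆G , e , e∈G , e∉F) with flatF e
  ... | inj₁ e∈F = contradiction e∈F e∉F
  ... | inj₂ rkF<rkF∪e = ℕP.<-≤-trans rkF<rkF∪e (rk-mono M (F ∪ ⁅ e ⁆) G F∪e⊆G)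
    where
    F∪e⊆G : F ∪ ⁅ e ⁆ ⊆ G
    F∪e⊆G x∈F∪e with x∈p∪q⁻ F ⁅ e ⁆ x∈F∪e
    ... | inj₁ x∈F = F⊆G x∈F
    ... | inj₂ x∈e = subst (_∈ G) (sym (x∈⁅y⁆⇒x≡y e x∈e)) e∈G

  VanishesInNonPositiveDegrees : HElt n → Set
  VanishesInNonPositiveDegrees α = ∀ F → IsFlat M F → ∀ k → k ≤ 0ℤ → α F k ≡ 0ℤ

  UpSumsPalindromic : HElt n → Set
  UpSumsPalindromic α = ∀ F → IsFlat M F → Pal0 (upSum M α F)

  upSum-vanishingAbove : ∀ α F → IsFlat M F →
                         (∀ G → IsFlat M G → F ⊂ G → ∀ j → α G j ≡ 0ℤ) →
                         ∀ k → upSum M α F k ≡ α F k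
  upSum-vanishingAbove α F flatF α≗0 k = trans
    (ΣL-single _ F flatF (λ G flatG G≢F →
      when-vanishes (F ⊆? G) (λ F⊆G → α≗0 G flatG (⊆∧≢⇒⊂ F⊆G (G≢F ∘ sym)) _)))
    (trans (when-holds (F ⊆? F) ⊆-refl _) (cong (α F) (+-inverse k (rkℤ M F))))
    where
    +-inverse : ∀ k r → k + (r - r) ≡ k
    +-inverse = solve-∀

  palindromic∧vanishing⇒≈0 : ∀ {α} → VanishesInNonPositiveDegrees α → UpSumsPalindromic α →
                             α ≈H[ M ] 0ᴴ
  palindromic∧vanishing⇒≈0 {α} α≤0≗0 αpal F flatF =
    <-rec Vanishes step (n ∸ rk M F) F flatF refl
    where
    Vanishes : ℕ → Set
    Vanishes d = ∀ F → IsFlat M F → n ∸ rk M F ≡ d → ∀ k → α F k ≡ 0ℤ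
    step : ∀ d → (∀ {d′} → d′ ℕ.< d → Vanishes d′) → Vanishes d
    step _ IH F flatF refl k with k ℤ.≤? 0ℤ
    ... | yes k≤0 = α≤0≗0 F flatF k k≤0
    ... | no k≰0  = begin
      α F k              ≡⟨ upSum-vanishingAbove α F flatF above k ⟨
      upSum M α F k      ≡⟨ αpal F flatF k ⟩
      upSum M α F (- k)  ≡⟨ upSum-vanishingAbove α F flatF above (- k) ⟩
      α F (- k)          ≡⟨ α≤0≗0 F flatF (- k) (ℤP.<⇒≤ (ℤP.neg-mono-< (ℤP.≰⇒> k≰0))) ⟩
      0ℤ                 ∎
      where
      open ≡-Reasoning
      above : ∀ G → IsFlat M G → F ⊂ G → ∀ j → α G j ≡ 0ℤ
      above G flatG F⊂G = IH (ℕP.∸-monoʳ-< (flat-⊂⇒rk< flatF F⊂G) (rk≤n G)) G flatG refl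

  upSum-- : ∀ α β F k → upSum M (α -ᴴ β) F k ≡ upSum M α F k - upSum M β F k
  upSum-- α β F k =
    trans (cong sumℤ (List.map-cong (λ G → when-distrib-- (F ⊆? G) _ _) (flats M)))
          (sumℤ-map-- _ _ (flats M))

  upSumsPalindromic-- : ∀ α β → UpSumsPalindromic α → UpSumsPalindromic β →
                        UpSumsPalindromic (α -ᴴ β)
  upSumsPalindromic-- α β αpal βpal F flatF k = begin
    upSum M (α -ᴴ β) F k                   ≡⟨ upSum-- α β F k ⟩
    upSum M α F k - upSum M β F k          ≡⟨ cong₂ _-_ (αpal F flatF k) (βpal F flatF k) ⟩
    upSum M α F (- k) - upSum M β F (- k)  ≡⟨ upSum-- α β F (- k) ⟨
    upSum M (α -ᴴ β) F (- k)               ∎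
    where open ≡-Reasoning

module _ {n} (M : Matroid n) (P : KLFamily n) where

  ζ-vanishes : ∀ F G k → (∀ q → G ⊆ F → (rkℤ M F - rkℤ M G) - k ≡ + 2 * q → P G F q ≡ 0ℤ) →
               ζ M P F G k ≡ 0ℤ
  ζ-vanishes F G k P≗0 = when-vanishes (G ⊆? F) vanishesBelowF
    where
    r = rkℤ M F - rkℤ M G
    vanishesBelowF : G ⊆ F → tPowInv2 r (P G F) k ≡ 0ℤ
    vanishesBelowF G⊆F with parityView (r - k)
    ... | even q e = trans (tPowInv2-even r (P G F) k q e) (P≗0 q G⊆F e)
    ... | odd q e  = tPowInv2-odd r (P G F) k q e

  upSum-ζ : ∀ F H k → upSum M (ζ M P F) H k ≡ tPowInv2 (rkℤ M F - rkℤ M H) (ZKL M P H F) k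
  upSum-ζ F H k = trans (cong sumℤ (List.map-cong shiftTerm (flats M)))
                        (sym (tPowInv2-sumℤ r ZKL-term (flats M) k))
    where
    r = rkℤ M F - rkℤ M H
    ZKL-term : Subset n → ℤ → ℤ
    ZKL-term G j = when (H ⊆? G) (when (G ⊆? F) (P G F (j - (rkℤ M G - rkℤ M H))))
    telescope : ∀ f g h → (f - g) + (g - h) ≡ f - h
    telescope = solve-∀
    shiftTerm : ∀ G → when (H ⊆? G) (ζ M P F G (k + (rkℤ M G - rkℤ M H))) ≡
                      tPowInv2 r (ZKL-term G) k
    shiftTerm G = begin
      when (H ⊆? G) (when (G ⊆? F) (tPowInv2 (rkℤ M F - rkℤ M G) (P G F) (k + s)))
        ≡⟨ cong (λ x → when (H ⊆? G) (when (G ⊆? F) x))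
                (tPowInv2-shift (rkℤ M F - rkℤ M G) s (P G F) k) ⟩
      when (H ⊆? G) (when (G ⊆? F) (tPowInv2 ((rkℤ M F - rkℤ M G) + s) (λ j → P G F (j - s)) k))
        ≡⟨ cong (λ r′ → when (H ⊆? G) (when (G ⊆? F) (tPowInv2 r′ (λ j → P G F (j - s)) k)))
                (telescope (rkℤ M F) (rkℤ M G) (rkℤ M H)) ⟩
      when (H ⊆? G) (when (G ⊆? F) (tPowInv2 r (λ j → P G F (j - s)) k))
        ≡⟨ cong (when (H ⊆? G)) (tPowInv2-when (G ⊆? F) r _ k) ⟩
      when (H ⊆? G) (tPowInv2 r (λ j → when (G ⊆? F) (P G F (j - s))) k)
        ≡⟨ tPowInv2-when (H ⊆? G) r _ k ⟩
      tPowInv2 r (ZKL-term G) k ∎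
      where
      open ≡-Reasoning
      s = rkℤ M G - rkℤ M H

  ZKL-vanishes : ∀ {H F} → ¬ H ⊆ F → ∀ j → ZKL M P H F j ≡ 0ℤ
  ZKL-vanishes H⊈F j = sumℤ-zero _ (flats M) λ G →
    when-vanishes (_ ⊆? G) λ H⊆G → when-vanishes (G ⊆? _) λ G⊆F →
      contradiction (λ {x} → ⊆-trans H⊆G G⊆F {x}) H⊈F

  upSum-ζComb : ∀ c H k → upSum M (ζComb M P c) H k ≡ ΣL M (λ F → c F * upSum M (ζ M P F) H k)
  upSum-ζComb c H k = begin
    sumℤ (map (λ G → when (H ⊆? G) (sumℤ (map (λ F → c F * ζ M P F G (k′ G)) L))) L)
      ≡⟨ cong sumℤ (List.map-cong (λ G → when-sumℤ (H ⊆? G) _ L) L) ⟩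
    sumℤ (map (λ G → sumℤ (map (λ F → when (H ⊆? G) (c F * ζ M P F G (k′ G))) L)) L)
      ≡⟨ sumℤ-swap (λ G F → when (H ⊆? G) (c F * ζ M P F G (k′ G))) L L ⟩
    sumℤ (map (λ F → sumℤ (map (λ G → when (H ⊆? G) (c F * ζ M P F G (k′ G))) L)) L)
      ≡⟨ cong sumℤ (List.map-cong (λ F → trans
           (cong sumℤ (List.map-cong (λ G → when-*ˡ (H ⊆? G) (c F) _) L))
           (sumℤ-map-*ˡ (c F) _ L)) L) ⟩
    sumℤ (map (λ F → c F * upSum M (ζ M P F) H k) L) ∎
    where
    open ≡-Reasoning
    L = flats M
    k′ : Subset n → ℤ
    k′ G = k + (rkℤ M G - rkℤ M H)

module _ {n} (M : Matroid n) (P : KLFamily n) (kl : IsKL M P) where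
  open IsKL kl

  P-aboveHalfRank : ∀ {G F} → IsFlat M G → IsFlat M F → G ⊆ F →
                    ∀ q → rkℤ M F - rkℤ M G < + 2 * q → P G F q ≡ 0ℤ
  P-aboveHalfRank {G} {F} flatG flatF G⊆F q r<2q with rk M G ℕP.<? rk M F
  ... | yes rkG<rkF = degree G F flatG flatF G⊆F rkG<rkF q (ℤP.<⇒≤ r<2q)
  ... | no rkG≮rkF  = trans (rank0 G F flatG flatF G⊆F rkF≡rkG q)
                            (cong (if_then 1ℤ else 0ℤ) (dec-false (q ℤ.≟ 0ℤ) q≢0))
    where
    rkF≡rkG : rk M F ≡ rk M G
    rkF≡rkG = ℕP.≤-antisym (ℕP.≮⇒≥ rkG≮rkF) (rk-mono M G F G⊆F)
    q≢0 : q ≢ 0ℤ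
    q≢0 refl = ℤP.<-irrefl
      (trans (cong (λ m → + m - rkℤ M G) rkF≡rkG) (ℤP.+-inverseʳ (rkℤ M G))) r<2q

  ζ-polynomial : ∀ F G → IsFlat M F → IsFlat M G → InZt (ζ M P F G)
  ζ-polynomial F G flatF flatG = belowZero , n , aboveN
    where
    r = rkℤ M F - rkℤ M G
    belowZero : ∀ k → k < 0ℤ → ζ M P F G k ≡ 0ℤ
    belowZero k k<0 = ζ-vanishes M P F G k λ q G⊆F r-k≡2q →
      P-aboveHalfRank flatG flatF G⊆F q (subst (r <_) r-k≡2q r<r-k)
      where
      r<r-k : r < r - k
      r<r-k = subst (_< r - k) (ℤP.+-identityʳ r) (ℤP.+-monoʳ-< r (ℤP.neg-mono-< k<0))
    aboveN : ∀ k → + n < k → ζ M P F G k ≡ 0ℤ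
    aboveN k n<k = ζ-vanishes M P F G k λ q G⊆F r-k≡2q →
      poly G F flatG flatF G⊆F q (ℤP.*-cancelˡ-<-nonNeg (+ 2) (subst (_< 0ℤ) r-k≡2q r-k<0))
      where
      r≤n : r ≤ + n
      r≤n = ℤP.≤-trans (ℤP.i-j≤i (rkℤ M F) (rkℤ M G)) (+≤+ (rk≤n M F))
      r-k<0 : r - k < 0ℤ
      r-k<0 = subst (r - k <_) (ℤP.+-inverseʳ k) (ℤP.+-monoˡ-< (- k) (ℤP.≤-<-trans r≤n n<k))

  ζ-diagonal-0 : ∀ F → IsFlat M F → ζ M P F F 0ℤ ≡ 1ℤ
  ζ-diagonal-0 F flatF = trans (when-holds (F ⊆? F) ⊆-refl _)
    (trans (tPowInv2-even (rkℤ M F - rkℤ M F) (P F F) 0ℤ 0ℤ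
              (trans (ℤP.+-identityʳ _) (ℤP.+-inverseʳ (rkℤ M F))))
           (rank0 F F flatF flatF ⊆-refl refl 0ℤ))

  ζ-offDiagonal-0 : ∀ F G → IsFlat M F → IsFlat M G → F ≢ G → ζ M P F G 0ℤ ≡ 0ℤ
  ζ-offDiagonal-0 F G flatF flatG F≢G = ζ-vanishes M P F G 0ℤ λ q G⊆F r-0≡2q →
    degree G F flatG flatF G⊆F (flat-⊂⇒rk< M flatG (⊆∧≢⇒⊂ G⊆F (F≢G ∘ sym))) q
      (ℤP.≤-reflexive (trans (sym (ℤP.+-identityʳ _)) r-0≡2q))

  ZKL-palindromic : ∀ F H → IsFlat M F → IsFlat M H →
                    ∀ i → ZKL M P H F i ≡ ZKL M P H F ((rkℤ M F - rkℤ M H) - i)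
  ZKL-palindromic F H flatF flatH i with H ⊆? F
  ... | yes H⊆F = palin H F flatH flatF H⊆F i
  ... | no H⊈F  =
    trans (ZKL-vanishes M P H⊈F i) (sym (ZKL-vanishes M P H⊈F ((rkℤ M F - rkℤ M H) - i)))

  ζ-upSumsPalindromic : ∀ F → IsFlat M F → UpSumsPalindromic M (ζ M P F)
  ζ-upSumsPalindromic F flatF H flatH k = begin
    upSum M (ζ M P F) H k
      ≡⟨ upSum-ζ M P F H k ⟩
    tPowInv2 r (ZKL M P H F) k
      ≡⟨ tPowInv2-reflect r (ZKL M P H F) k ⟩
    tPowInv2 r (λ i → ZKL M P H F (r - i)) (- k)
      ≡⟨ tPowInv2-cong r (- k) (λ i → sym (ZKL-palindromic F H flatF flatH i)) ⟩
    tPowInv2 r (ZKL M P H F) (- k)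
      ≡⟨ upSum-ζ M P F H (- k) ⟨
    upSum M (ζ M P F) H (- k) ∎
    where
    open ≡-Reasoning
    r = rkℤ M F - rkℤ M H

  ζ∈Hp : ∀ F → IsFlat M F → InHp M (ζ M P F)
  ζ∈Hp F flatF = (λ G flatG → ζ-polynomial F G flatF flatG) , ζ-upSumsPalindromic F flatF

  ζComb-at-0 : ∀ c G → IsFlat M G → ζComb M P c G 0ℤ ≡ c G
  ζComb-at-0 c G flatG = trans
    (ΣL-single M _ G flatG λ F flatF F≢G →
      trans (cong (c F *_) (ζ-offDiagonal-0 F G flatF flatG F≢G)) (ℤP.*-zeroʳ (c F)))
    (trans (cong (c G *_) (ζ-diagonal-0 G flatG)) (ℤP.*-identityʳ (c G)))

  ζComb-negative : ∀ c G → IsFlat M G → ∀ k → k < 0ℤ → ζComb M P c G k ≡ 0ℤ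
  ζComb-negative c G flatG k k<0 = ΣL-vanishes M λ F flatF →
    trans (cong (c F *_) (proj₁ (ζ-polynomial F G flatF flatG) k k<0)) (ℤP.*-zeroʳ (c F))

  ζComb-upSumsPalindromic : ∀ c → UpSumsPalindromic M (ζComb M P c)
  ζComb-upSumsPalindromic c H flatH k = begin
    upSum M (ζComb M P c) H k
      ≡⟨ upSum-ζComb M P c H k ⟩
    ΣL M (λ F → c F * upSum M (ζ M P F) H k)
      ≡⟨ ΣL-cong M (λ F flatF → cong (c F *_) (ζ-upSumsPalindromic F flatF H flatH k)) ⟩
    ΣL M (λ F → c F * upSum M (ζ M P F) H (- k))
      ≡⟨ upSum-ζComb M P c H (- k) ⟨
    upSum M (ζComb M P c) H (- k) ∎
    where open ≡-Reasoning

  residual-vanishesInNonPositiveDegrees : ∀ β → InHp M β →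
    VanishesInNonPositiveDegrees M (β -ᴴ ζComb M P (λ F → β F 0ℤ))
  residual-vanishesInNonPositiveDegrees β (βpoly , _) F flatF k k≤0 with k ℤ.≟ 0ℤ
  ... | yes refl = trans (cong (λ x → β F 0ℤ - x) (ζComb-at-0 (λ G → β G 0ℤ) F flatF))
                         (ℤP.+-inverseʳ (β F 0ℤ))
  ... | no k≢0   = cong₂ _-_ (proj₁ (βpoly F flatF) k k<0)
                             (ζComb-negative (λ G → β G 0ℤ) F flatF k k<0)
    where
    k<0 = ℤP.≤∧≢⇒< k≤0 k≢0

proposition2p13 : ∀ {n} (M : Matroid n) → IsSimple M →
    (P : KLFamily n) → IsKL M P →
    -- each ζ^F lies in H_p(M)
    (∀ F → IsFlat M F → InHp M (ζ M P F))
    -- the ζ^F are ℤ-linearly independent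
    × (∀ (c : Subset n → ℤ) → ζComb M P c ≈H[ M ] (λ _ _ → 0ℤ) →
         ∀ F → IsFlat M F → c F ≡ 0ℤ)
    -- every β ∈ H_p(M) equals Σ_F β_F(0) ζ^F (so the ζ^F span H_p(M))
    × (∀ (β : HElt n) → InHp M β →
         β ≈H[ M ] ζComb M P (λ F → β F 0ℤ))
proposition2p13 M _ P kl = ζ∈Hp M P kl , independent , spanning
  where
  independent : ∀ c → ζComb M P c ≈H[ M ] 0ᴴ → ∀ F → IsFlat M F → c F ≡ 0ℤ
  independent c ζc≈0 F flatF = trans (sym (ζComb-at-0 M P kl c F flatF)) (ζc≈0 F flatF 0ℤ)

  spanning : ∀ β → InHp M β → β ≈H[ M ] ζComb M P (λ F → β F 0ℤ)
  spanning β β∈Hp G flatG k = ℤP.i-j≡0⇒i≡j _ _ (residual≈0 G flatG k)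
    where
    c₀ : Subset _ → ℤ
    c₀ F = β F 0ℤ
    residual≈0 : (β -ᴴ ζComb M P c₀) ≈H[ M ] 0ᴴ
    residual≈0 = palindromic∧vanishing⇒≈0 M
      (residual-vanishesInNonPositiveDegrees M P kl β β∈Hp)
      (upSumsPalindromic-- M β (ζComb M P c₀) (proj₂ β∈Hp) (ζComb-upSumsPalindromic M P kl c₀))
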